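{- Let $(F_n)_{n\ge1}$ be the Fibonacci numbers, $F_1=F_2=1$, $F_{n}=F_{n-1}+F_{n-2}$. Then for every integer $n\ge0$, $$\sum_{k=0}^n\binom{k+1}{n-k}=F_{n+2}\qquad\text{and}\qquad\sum_{k=0}^n\frac{k+1}{n+1}\binom{2n-k}{n}(-1)^{n-k}F_{k+2}=1.$$
   Context: Binomial coefficients $\binom{a}{b}$ with $b>a\ge0$ are $0$. -}

module Defs where

open import Data.Nat using (ℕ; zero; suc; _+_)

-- Fibonacci numbers: fib 0 = 0, fib 1 = 1, fib (n+2) = fib (n+1) + fib n,
-- so fib 1 = fib 2 = 1 as in the paper.
fib : ℕ → ℕ
fib zero = 0
fib (suc zero) = 1
fib (suc (suc n)) = fib (suc n) + fib n

sumTo : {A : Set} → A → (A → A → A) → ℕ → (ℕ → A) → A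
sumTo z _⊕_ zero f = f zero
sumTo z _⊕_ (suc n) f = sumTo z _⊕_ n f ⊕ f (suc n)

module Submission where

-- (1) The shallow diagonals  diagonal n = ∑_{k ≤ n} C(k, n−k)  of Pascal's
-- triangle satisfy the Fibonacci recurrence (apply Pascal's rule termwise), and
-- the sum in (1) is diagonal (n+1) because its k = 0 term C(0, n+1) vanishes.
--
-- (2) By absorption, (k+1)·C(2n−k, n) = (n+1)·(C(2n−k, n) − C(2n−k, n+1)), so
-- after clearing the common denominator n+1 it remains to show
-- ∑_{k ≤ n} b(n,k) F_{k+2} = 1 for the signed ballot numbers
-- b(n,k) = (−1)^{n−k} (C(2n−k, n) − C(2n−k, n+1)).  These satisfy
-- b(n+1,k+1) + b(n+1,k+2) = b(n,k), b(n+1,0) + b(n+1,1) = 0 and b(n+1,n+2) = 0,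
-- so summation by parts against F_{k+3} = F_{k+2} + F_{k+1} shows that the sum
-- does not depend on n; for n = 0 it is 1.

open import Defs
open import Level using (0ℓ)
open import Algebra.Bundles using (CommutativeMonoid)
open import Data.Nat using (ℕ; zero; suc; _+_; _*_; _∸_; _≤_; _<_; z≤n; s≤s)
open import Data.Nat.Properties
open import Data.Nat.Combinatorics
  using (_C_; nCk≡nC[n∸k]; nC1≡n; k>n⇒nCk≡0) renaming (nCk+nC[k+1]≡[n+1]C[k+1] to pascal)
open import Data.Nat.Tactic.RingSolver using (solve-∀)
open import Data.Integer using (ℤ; +_; -_; 0ℤ; 1ℤ)
  renaming (_+_ to _+ℤ_; _-_ to _-ℤ_; _*_ to _*ℤ_; _^_ to _^ℤ_)
import Data.Integer.Properties as ℤ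
import Data.Integer.Tactic.RingSolver as ℤ-Ring
open import Data.Rational using (_/_; 0ℚ; 1ℚ; toℚᵘ)
  renaming (_+_ to _+ℚ_; _*_ to _*ℚ_)
import Data.Rational.Properties as ℚ
open import Data.Rational.Unnormalised using (mkℚᵘ; _≃_; *≡*; 1ℚᵘ)
  renaming (_+_ to _+ᵘ_; _*_ to _*ᵘ_)
import Data.Rational.Unnormalised.Properties as ℚᵘ
open import Data.Product using (_×_; _,_)
open import Data.Sum using (inj₁; inj₂)
open import Relation.Binary.PropositionalEquality

module FiniteSum {ℓ} (M : CommutativeMonoid 0ℓ ℓ) where
  open CommutativeMonoid M
    using (Carrier; _≈_; _∙_; ε; ∙-cong; assoc; commutativeSemigroup)
    renaming (refl to ≈-refl; trans to ≈-trans)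
  open import Algebra.Properties.CommutativeSemigroup commutativeSemigroup using (interchange)

  ∑ : ℕ → (ℕ → Carrier) → Carrier
  ∑ = sumTo ε _∙_

  sum-cong : ∀ n {f g : ℕ → Carrier} → (∀ k → k ≤ n → f k ≈ g k) → ∑ n f ≈ ∑ n g
  sum-cong zero    eq = eq 0 z≤n
  sum-cong (suc n) eq = ∙-cong (sum-cong n (λ k k≤n → eq k (m≤n⇒m≤1+n k≤n))) (eq (suc n) ≤-refl)

  sum-∙ : ∀ n (f g : ℕ → Carrier) → ∑ n (λ k → f k ∙ g k) ≈ ∑ n f ∙ ∑ n g
  sum-∙ zero    f g = ≈-refl
  sum-∙ (suc n) f g = ≈-trans (∙-cong (sum-∙ n f g) ≈-refl) (interchange _ _ _ _)

  sum-shift : ∀ n (f : ℕ → Carrier) → ∑ (suc n) f ≈ f 0 ∙ ∑ n (λ k → f (suc k))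
  sum-shift zero    f = ≈-refl
  sum-shift (suc n) f = ≈-trans (∙-cong (sum-shift n f) ≈-refl) (assoc _ _ _)

  sum-homo : {A : Set} {z : A} {_⊕_ : A → A → A} (h : A → Carrier) →
             (∀ x y → h (x ⊕ y) ≈ h x ∙ h y) →
             ∀ n (f : ℕ → A) → h (sumTo z _⊕_ n f) ≈ ∑ n (λ k → h (f k))
  sum-homo h homo zero    f = ≈-refl
  sum-homo {z = z} h homo (suc n) f = ≈-trans (homo _ _) (∙-cong (sum-homo {z = z} h homo n f) ≈-refl)

module NatSum = FiniteSum +-0-commutativeMonoid
open NatSum using (∑)

absorption : ∀ m k → suc k * (suc m C suc k) ≡ suc m * (m C k)
absorption m       zero    = trans (+-identityʳ _) (trans (nC1≡n (suc m)) (sym (*-identityʳ _)))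
absorption zero    (suc k) = *-zeroʳ (suc (suc k))
absorption (suc m) (suc k) = begin
    suc (suc k) * (suc (suc m) C suc (suc k))
  ≡⟨ cong (suc (suc k) *_) (sym (pascal (suc m) (suc k))) ⟩
    suc (suc k) * (a + b)
  ≡⟨ regroup k a b ⟩
    (suc k * a + suc (suc k) * b) + a
  ≡⟨ cong₂ (λ x y → x + y + a) (absorption m k) (absorption m (suc k)) ⟩
    (suc m * (m C k) + suc m * (m C suc k)) + a
  ≡⟨ cong (_+ a) (sym (*-distribˡ-+ (suc m) (m C k) (m C suc k))) ⟩
    suc m * (m C k + m C suc k) + a
  ≡⟨ cong (λ x → suc m * x + a) (pascal m k) ⟩
    suc m * a + a
  ≡⟨ +-comm (suc m * a) a ⟩
    suc (suc m) * a
  ∎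
  where
  open ≡-Reasoning
  a = suc m C suc k
  b = suc m C suc (suc k)
  regroup : ∀ k a b → suc (suc k) * (a + b) ≡ (suc k * a + suc (suc k) * b) + a
  regroup = solve-∀

diagonal : ℕ → ℕ
diagonal n = ∑ n (λ k → k C (n ∸ k))

-- The term k = 0 vanishes, leaving the sum of the theorem.
diagonal-suc : ∀ n → diagonal (suc n) ≡ ∑ n (λ k → suc k C (n ∸ k))
diagonal-suc n = NatSum.sum-shift n (λ k → k C (suc n ∸ k))

diagonal-last : ∀ n → diagonal (suc n) ≡ ∑ n (λ k → k C suc (n ∸ k)) + 1
diagonal-last n = cong₂ _+_ (NatSum.sum-cong n (λ k k≤n → cong (k C_) (+-∸-assoc 1 k≤n)))
                            (cong (suc n C_) (n∸n≡0 n))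

diagonal-rec : ∀ n → diagonal (suc (suc n)) ≡ diagonal n + diagonal (suc n)
diagonal-rec n = begin
    diagonal (suc (suc n))
  ≡⟨ diagonal-suc (suc n) ⟩
    ∑ n (λ k → suc k C (suc n ∸ k)) + suc (suc n) C (n ∸ n)
  ≡⟨ cong₂ _+_ (NatSum.sum-cong n pascal-step) (cong (suc (suc n) C_) (n∸n≡0 n)) ⟩
    ∑ n (λ k → k C (n ∸ k) + k C suc (n ∸ k)) + 1
  ≡⟨ cong (_+ 1) (NatSum.sum-∙ n _ _) ⟩
    (diagonal n + ∑ n (λ k → k C suc (n ∸ k))) + 1
  ≡⟨ +-assoc (diagonal n) _ 1 ⟩
    diagonal n + (∑ n (λ k → k C suc (n ∸ k)) + 1)
  ≡⟨ cong (_+_ (diagonal n)) (sym (diagonal-last n)) ⟩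
    diagonal n + diagonal (suc n)
  ∎
  where
  open ≡-Reasoning
  pascal-step : ∀ k → k ≤ n → suc k C (suc n ∸ k) ≡ k C (n ∸ k) + k C suc (n ∸ k)
  pascal-step k k≤n = trans (cong (suc k C_) (+-∸-assoc 1 k≤n)) (sym (pascal k (n ∸ k)))

diagonal≡fib : ∀ n → diagonal n ≡ fib (suc n)
diagonal≡fib zero          = refl
diagonal≡fib (suc zero)    = refl
diagonal≡fib (suc (suc n)) = begin
    diagonal (suc (suc n))
  ≡⟨ diagonal-rec n ⟩
    diagonal n + diagonal (suc n)
  ≡⟨ cong₂ _+_ (diagonal≡fib n) (diagonal≡fib (suc n)) ⟩
    fib (suc n) + fib (suc (suc n))
  ≡⟨ +-comm (fib (suc n)) _ ⟩
    fib (suc (suc (suc n)))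
  ∎
  where open ≡-Reasoning

diagonal-identity : ∀ n → ∑ n (λ k → (k + 1) C (n ∸ k)) ≡ fib (n + 2)
diagonal-identity n = begin
    ∑ n (λ k → (k + 1) C (n ∸ k))
  ≡⟨ NatSum.sum-cong n (λ k _ → cong (_C (n ∸ k)) (+-comm k 1)) ⟩
    ∑ n (λ k → suc k C (n ∸ k))
  ≡⟨ sym (diagonal-suc n) ⟩
    diagonal (suc n)
  ≡⟨ diagonal≡fib (suc n) ⟩
    fib (suc (suc n))
  ≡⟨ cong fib (+-comm 2 n) ⟩
    fib (n + 2)
  ∎
  where open ≡-Reasoning

ballot-absorption : ∀ {m n k} → m + k ≡ n + n →
                    suc k * (m C n) + suc n * (m C suc n) ≡ suc n * (m C n)
ballot-absorption {m} {n} {k} m+k≡2n = +-cancelˡ-≡ (suc n * c) _ _ (begin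
    suc n * c + (suc k * c + suc n * c')
  ≡⟨ regroup (suc n) (suc k) c c' ⟩
    suc k * c + suc n * (c + c')
  ≡⟨ cong (λ x → suc k * c + suc n * x) (pascal m n) ⟩
    suc k * c + suc n * (suc m C suc n)
  ≡⟨ cong (_+_ (suc k * c)) (absorption m n) ⟩
    suc k * c + suc m * c
  ≡⟨ sym (*-distribʳ-+ c (suc k) (suc m)) ⟩
    (suc k + suc m) * c
  ≡⟨ cong (_* c) k+m≡2n ⟩
    (suc n + suc n) * c
  ≡⟨ *-distribʳ-+ c (suc n) (suc n) ⟩
    suc n * c + suc n * c
  ∎)
  where
  open ≡-Reasoning
  c = m C n
  c' = m C suc n
  regroup : ∀ a b x y → a * x + (b * x + a * y) ≡ b * x + a * (x + y)
  regroup = solve-∀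
  k+m≡2n : suc k + suc m ≡ suc n + suc n
  k+m≡2n = begin
      suc k + suc m       ≡⟨ cong suc (+-suc k m) ⟩
      suc (suc (k + m))   ≡⟨ cong (λ x → suc (suc x)) (trans (+-comm k m) m+k≡2n) ⟩
      suc (suc (n + n))   ≡⟨ cong suc (sym (+-suc n n)) ⟩
      suc n + suc n       ∎

double-suc : ∀ n → 2 * suc n ≡ suc (suc (2 * n))
double-suc = solve-∀

double≡+ : ∀ n → 2 * n ≡ n + n
double≡+ n = cong (_+_ n) (+-identityʳ n)

double∸self : ∀ n → 2 * n ∸ n ≡ n
double∸self n = trans (cong (_∸ n) (double≡+ n)) (m+n∸n≡m n n)

≤double : ∀ {n k} → k ≤ n → k ≤ 2 * n
≤double {n} k≤n = ≤-trans k≤n (m≤n*m n 2)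

double-complement : ∀ {n k} → k ≤ n → (2 * n ∸ k) + k ≡ n + n
double-complement {n} k≤n = trans (m∸n+n≡m (≤double k≤n)) (double≡+ n)

double-suc∸suc : ∀ {n k} → k ≤ n → 2 * suc n ∸ suc k ≡ suc (2 * n ∸ k)
double-suc∸suc {n} {k} k≤n = trans (cong (_∸ suc k) (double-suc n)) (+-∸-assoc 1 (≤double k≤n))

double-suc∸suc-suc : ∀ n k → 2 * suc n ∸ suc (suc k) ≡ 2 * n ∸ k
double-suc∸suc-suc n k = cong (_∸ suc (suc k)) (double-suc n)

-- The difference C(m, j) − C(m, j+1); for m = 2n − k and j = n these are the
-- ballot numbers (entries of Catalan's triangle).
binomDiff : ℕ → ℕ → ℤ
binomDiff m j = + (m C j) -ℤ + (m C suc j)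

binomDiff-pascal : ∀ m j → binomDiff (suc m) (suc j) ≡ binomDiff m j +ℤ binomDiff m (suc j)
binomDiff-pascal m j = begin
    + (suc m C suc j) -ℤ + (suc m C suc (suc j))
  ≡⟨ cong₂ (λ x y → + x -ℤ + y) (sym (pascal m j)) (sym (pascal m (suc j))) ⟩
    + (a + b) -ℤ + (b + c)
  ≡⟨ cong₂ _-ℤ_ (ℤ.pos-+ a b) (ℤ.pos-+ b c) ⟩
    (+ a +ℤ + b) -ℤ (+ b +ℤ + c)
  ≡⟨ telescope (+ a) (+ b) (+ c) ⟩
    (+ a -ℤ + b) +ℤ (+ b -ℤ + c)
  ∎
  where
  open ≡-Reasoning
  a = m C j
  b = m C suc j
  c = m C suc (suc j)
  telescope : ∀ x y z → (x +ℤ y) -ℤ (y +ℤ z) ≡ (x -ℤ y) +ℤ (y -ℤ z)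
  telescope = ℤ-Ring.solve-∀

binomDiff-vanish : ∀ {m j} → m < j → binomDiff m j ≡ 0ℤ
binomDiff-vanish m<j rewrite k>n⇒nCk≡0 m<j | k>n⇒nCk≡0 (m<n⇒m<1+n m<j) = refl

-- The central coefficients of row 2n+1 agree, so their difference vanishes.
binomDiff-middle : ∀ n → binomDiff (suc (2 * n)) n ≡ 0ℤ
binomDiff-middle n = begin
    + (suc (2 * n) C n) -ℤ + (suc (2 * n) C suc n)
  ≡⟨ cong (λ x → + x -ℤ + (suc (2 * n) C suc n)) symmetric ⟩
    + (suc (2 * n) C suc n) -ℤ + (suc (2 * n) C suc n)
  ≡⟨ ℤ.+-inverseʳ (+ (suc (2 * n) C suc n)) ⟩
    0ℤ
  ∎
  where
  open ≡-Reasoning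
  n≤2n = ≤double {n} ≤-refl
  symmetric : suc (2 * n) C n ≡ suc (2 * n) C suc n
  symmetric = trans (nCk≡nC[n∸k] (m≤n⇒m≤1+n n≤2n))
                    (cong (suc (2 * n) C_) (trans (+-∸-assoc 1 n≤2n) (cong suc (double∸self n))))

binomDiff-absorption : ∀ {m n k} → m + k ≡ n + n →
                       + suc k *ℤ + (m C n) ≡ + suc n *ℤ binomDiff m n
binomDiff-absorption {m} {n} {k} m+k≡2n = begin
    + suc k *ℤ + c
  ≡⟨ sym (ℤ.pos-* (suc k) c) ⟩
    + (suc k * c)
  ≡⟨ cancel (suc k * c) (suc n * c') ⟩
    (+ (suc k * c + suc n * c')) -ℤ + (suc n * c')
  ≡⟨ cong (λ x → + x -ℤ + (suc n * c')) (ballot-absorption {m} {n} {k} m+k≡2n) ⟩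
    + (suc n * c) -ℤ + (suc n * c')
  ≡⟨ cong₂ _-ℤ_ (ℤ.pos-* (suc n) c) (ℤ.pos-* (suc n) c') ⟩
    + suc n *ℤ + c -ℤ + suc n *ℤ + c'
  ≡⟨ factor (+ suc n) (+ c) (+ c') ⟩
    + suc n *ℤ (+ c -ℤ + c')
  ∎
  where
  open ≡-Reasoning
  c = m C n
  c' = m C suc n
  add-sub : ∀ x y → x ≡ (x +ℤ y) -ℤ y
  add-sub = ℤ-Ring.solve-∀
  cancel : ∀ a b → + a ≡ + (a + b) -ℤ + b
  cancel a b = trans (add-sub (+ a) (+ b)) (cong (_-ℤ + b) (sym (ℤ.pos-+ a b)))
  factor : ∀ x y z → x *ℤ y -ℤ x *ℤ z ≡ x *ℤ (y -ℤ z)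
  factor = ℤ-Ring.solve-∀

sign : ℕ → ℕ → ℤ
sign n k = (- (+ 1)) ^ℤ (n ∸ k)

sign-cancel : ∀ {n k} → k < n → sign n k +ℤ sign n (suc k) ≡ 0ℤ
sign-cancel {suc n} {k} (s≤s k≤n) = begin
    (- (+ 1)) ^ℤ (suc n ∸ k) +ℤ t
  ≡⟨ cong (λ e → (- (+ 1)) ^ℤ e +ℤ t) (+-∸-assoc 1 k≤n) ⟩
    (- (+ 1)) *ℤ t +ℤ t
  ≡⟨ opposite t ⟩
    0ℤ
  ∎
  where
  open ≡-Reasoning
  t = (- (+ 1)) ^ℤ (n ∸ k)
  opposite : ∀ x → (- (+ 1)) *ℤ x +ℤ x ≡ 0ℤ
  opposite = ℤ-Ring.solve-∀

ballot : ℕ → ℕ → ℤ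
ballot n k = sign n k *ℤ binomDiff (2 * n ∸ k) n

-- The correction term in the ballot recurrence vanishes: for k < n the signs
-- cancel, and for k = n the difference C(n, n+1) − C(n, n+2) is zero.
ballot-boundary : ∀ {n k} → k ≤ n →
                  (sign n k +ℤ sign n (suc k)) *ℤ binomDiff (2 * n ∸ k) (suc n) ≡ 0ℤ
ballot-boundary {n} {k} k≤n with m≤n⇒m<n∨m≡n k≤n
... | inj₁ k<n  = trans (cong (_*ℤ binomDiff (2 * n ∸ k) (suc n)) (sign-cancel k<n))
                        (ℤ.*-zeroˡ (binomDiff (2 * n ∸ k) (suc n)))
... | inj₂ refl = trans (cong ((sign n n +ℤ sign n (suc n)) *ℤ_)
                              (binomDiff-vanish (s≤s (≤-reflexive (double∸self n)))))
                        (ℤ.*-zeroʳ (sign n n +ℤ sign n (suc n)))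

ballot-rec : ∀ {n k} → k ≤ n → ballot (suc n) (suc k) +ℤ ballot (suc n) (suc (suc k)) ≡ ballot n k
ballot-rec {n} {k} k≤n = begin
    σ *ℤ binomDiff (2 * suc n ∸ suc k) (suc n) +ℤ τ *ℤ binomDiff (2 * suc n ∸ suc (suc k)) (suc n)
  ≡⟨ cong₂ (λ a b → σ *ℤ binomDiff a (suc n) +ℤ τ *ℤ binomDiff b (suc n))
           (double-suc∸suc k≤n) (double-suc∸suc-suc n k) ⟩
    σ *ℤ binomDiff (suc m) (suc n) +ℤ τ *ℤ y
  ≡⟨ cong (λ z → σ *ℤ z +ℤ τ *ℤ y) (binomDiff-pascal m n) ⟩
    σ *ℤ (x +ℤ y) +ℤ τ *ℤ y
  ≡⟨ regroup σ τ x y ⟩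
    σ *ℤ x +ℤ (σ +ℤ τ) *ℤ y
  ≡⟨ cong (_+ℤ_ (σ *ℤ x)) (ballot-boundary k≤n) ⟩
    σ *ℤ x +ℤ 0ℤ
  ≡⟨ ℤ.+-identityʳ (σ *ℤ x) ⟩
    σ *ℤ x
  ∎
  where
  open ≡-Reasoning
  m = 2 * n ∸ k
  σ = sign n k
  τ = sign n (suc k)
  x = binomDiff m n
  y = binomDiff m (suc n)
  regroup : ∀ s t a b → s *ℤ (a +ℤ b) +ℤ t *ℤ b ≡ s *ℤ a +ℤ (s +ℤ t) *ℤ b
  regroup = ℤ-Ring.solve-∀

ballot-first : ∀ n → ballot (suc n) 0 +ℤ ballot (suc n) 1 ≡ 0ℤ
ballot-first n = begin
    (- (+ 1) *ℤ s) *ℤ binomDiff (2 * suc n) (suc n) +ℤ s *ℤ binomDiff (2 * suc n ∸ 1) (suc n)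
  ≡⟨ cong (λ a → (- (+ 1) *ℤ s) *ℤ binomDiff a (suc n) +ℤ s *ℤ binomDiff (a ∸ 1) (suc n))
          (double-suc n) ⟩
    (- (+ 1) *ℤ s) *ℤ binomDiff (suc (suc (2 * n))) (suc n) +ℤ s *ℤ z
  ≡⟨ cong (λ w → (- (+ 1) *ℤ s) *ℤ w +ℤ s *ℤ z) (binomDiff-pascal (suc (2 * n)) n) ⟩
    (- (+ 1) *ℤ s) *ℤ (binomDiff (suc (2 * n)) n +ℤ z) +ℤ s *ℤ z
  ≡⟨ cong (λ w → (- (+ 1) *ℤ s) *ℤ (w +ℤ z) +ℤ s *ℤ z) (binomDiff-middle n) ⟩
    (- (+ 1) *ℤ s) *ℤ (0ℤ +ℤ z) +ℤ s *ℤ z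
  ≡⟨ opposite s z ⟩
    0ℤ
  ∎
  where
  open ≡-Reasoning
  s = sign n 0
  z = binomDiff (suc (2 * n)) (suc n)
  opposite : ∀ a b → (- (+ 1) *ℤ a) *ℤ (0ℤ +ℤ b) +ℤ a *ℤ b ≡ 0ℤ
  opposite = ℤ-Ring.solve-∀

ballot-beyond : ∀ n → ballot (suc n) (suc (suc n)) ≡ 0ℤ
ballot-beyond n = begin
    sign (suc n) (suc (suc n)) *ℤ binomDiff (2 * suc n ∸ suc (suc n)) (suc n)
  ≡⟨ cong (λ a → sign (suc n) (suc (suc n)) *ℤ binomDiff a (suc n)) (double-suc∸suc-suc n n) ⟩
    sign (suc n) (suc (suc n)) *ℤ binomDiff (2 * n ∸ n) (suc n)
  ≡⟨ cong (_*ℤ_ (sign (suc n) (suc (suc n)))) (binomDiff-vanish (s≤s (≤-reflexive (double∸self n)))) ⟩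
    sign (suc n) (suc (suc n)) *ℤ 0ℤ
  ≡⟨ ℤ.*-zeroʳ (sign (suc n) (suc (suc n))) ⟩
    0ℤ
  ∎
  where open ≡-Reasoning

module IntSum = FiniteSum ℤ.+-0-commutativeMonoid

fibℤ : ℕ → ℤ
fibℤ k = + fib k

fib-summation-by-parts : ∀ n (β : ℕ → ℤ) →
  IntSum.∑ (suc n) (λ k → β k *ℤ fibℤ (suc (suc k))) +ℤ β (suc (suc n)) *ℤ fibℤ (suc (suc n))
  ≡ (β 0 +ℤ β 1) +ℤ IntSum.∑ n (λ k → (β (suc k) +ℤ β (suc (suc k))) *ℤ fibℤ (suc (suc k)))
fib-summation-by-parts zero β = base (β 0) (β 1) (β 2)
  where
  base : ∀ a b c → (a *ℤ + 1 +ℤ b *ℤ + 2) +ℤ c *ℤ + 1 ≡ (a +ℤ b) +ℤ (b +ℤ c) *ℤ + 1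
  base = ℤ-Ring.solve-∀
fib-summation-by-parts (suc n) β = begin
    (S +ℤ a *ℤ fibℤ (3 + suc n)) +ℤ b *ℤ u
  ≡⟨ cong (λ w → (S +ℤ a *ℤ w) +ℤ b *ℤ u) (ℤ.pos-+ (fib (3 + n)) (fib (2 + n))) ⟩
    (S +ℤ a *ℤ (u +ℤ v)) +ℤ b *ℤ u
  ≡⟨ regroup S a b u v ⟩
    (S +ℤ a *ℤ v) +ℤ (a +ℤ b) *ℤ u
  ≡⟨ cong (_+ℤ (a +ℤ b) *ℤ u) (fib-summation-by-parts n β) ⟩
    ((β 0 +ℤ β 1) +ℤ T) +ℤ (a +ℤ b) *ℤ u
  ≡⟨ ℤ.+-assoc (β 0 +ℤ β 1) T ((a +ℤ b) *ℤ u) ⟩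
    (β 0 +ℤ β 1) +ℤ (T +ℤ (a +ℤ b) *ℤ u)
  ∎
  where
  open ≡-Reasoning
  S = IntSum.∑ (suc n) (λ k → β k *ℤ fibℤ (suc (suc k)))
  T = IntSum.∑ n (λ k → (β (suc k) +ℤ β (suc (suc k))) *ℤ fibℤ (suc (suc k)))
  a = β (2 + n)
  b = β (3 + n)
  u = fibℤ (3 + n)
  v = fibℤ (2 + n)
  regroup : ∀ S a b u v → (S +ℤ a *ℤ (u +ℤ v)) +ℤ b *ℤ u ≡ (S +ℤ a *ℤ v) +ℤ (a +ℤ b) *ℤ u
  regroup = ℤ-Ring.solve-∀

-- ∑_{k ≤ n} b(n, k) F_{k+2} = 1: by summation by parts and the ballot
-- recurrences, the sum for row n+1 equals the sum for row n.
ballot-fib-sum : ∀ n → IntSum.∑ n (λ k → ballot n k *ℤ fibℤ (suc (suc k))) ≡ 1ℤ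
ballot-fib-sum zero    = refl
ballot-fib-sum (suc n) = begin
    IntSum.∑ (suc n) (λ k → β k *ℤ fibℤ (suc (suc k)))
  ≡⟨ sym (ℤ.+-identityʳ _) ⟩
    IntSum.∑ (suc n) (λ k → β k *ℤ fibℤ (suc (suc k))) +ℤ 0ℤ
  ≡⟨ cong (_+ℤ_ (IntSum.∑ (suc n) (λ k → β k *ℤ fibℤ (suc (suc k))))) (sym beyond) ⟩
    IntSum.∑ (suc n) (λ k → β k *ℤ fibℤ (suc (suc k))) +ℤ β (2 + n) *ℤ fibℤ (2 + n)
  ≡⟨ fib-summation-by-parts n β ⟩
    (β 0 +ℤ β 1) +ℤ IntSum.∑ n (λ k → (β (suc k) +ℤ β (suc (suc k))) *ℤ fibℤ (suc (suc k)))
  ≡⟨ cong₂ _+ℤ_ (ballot-first n)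
                (IntSum.sum-cong n (λ k k≤n → cong (_*ℤ fibℤ (suc (suc k))) (ballot-rec k≤n))) ⟩
    0ℤ +ℤ IntSum.∑ n (λ k → ballot n k *ℤ fibℤ (suc (suc k)))
  ≡⟨ ℤ.+-identityˡ _ ⟩
    IntSum.∑ n (λ k → ballot n k *ℤ fibℤ (suc (suc k)))
  ≡⟨ ballot-fib-sum n ⟩
    1ℤ
  ∎
  where
  open ≡-Reasoning
  β = ballot (suc n)
  beyond : β (2 + n) *ℤ fibℤ (2 + n) ≡ 0ℤ
  beyond = trans (cong (_*ℤ fibℤ (2 + n)) (ballot-beyond n)) (ℤ.*-zeroˡ (fibℤ (2 + n)))

weighted-term : ∀ {n k} → k ≤ n →
  + (k + 1) *ℤ ((+ ((2 * n ∸ k) C n) *ℤ sign n k) *ℤ + fib (k + 2))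
  ≡ + suc n *ℤ (ballot n k *ℤ fibℤ (suc (suc k)))
weighted-term {n} {k} k≤n = begin
    + (k + 1) *ℤ ((c *ℤ σ) *ℤ + fib (k + 2))
  ≡⟨ cong₂ (λ a b → + a *ℤ ((c *ℤ σ) *ℤ + fib b)) (+-comm k 1) (+-comm k 2) ⟩
    + suc k *ℤ ((c *ℤ σ) *ℤ f)
  ≡⟨ regroup₁ (+ suc k) c σ f ⟩
    (+ suc k *ℤ c) *ℤ (σ *ℤ f)
  ≡⟨ cong (_*ℤ (σ *ℤ f)) (binomDiff-absorption {2 * n ∸ k} {n} {k} (double-complement k≤n)) ⟩
    (+ suc n *ℤ binomDiff (2 * n ∸ k) n) *ℤ (σ *ℤ f)
  ≡⟨ regroup₂ (+ suc n) (binomDiff (2 * n ∸ k) n) σ f ⟩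
    + suc n *ℤ ((σ *ℤ binomDiff (2 * n ∸ k) n) *ℤ f)
  ∎
  where
  open ≡-Reasoning
  c = + ((2 * n ∸ k) C n)
  σ = sign n k
  f = fibℤ (suc (suc k))
  regroup₁ : ∀ p c s f → p *ℤ ((c *ℤ s) *ℤ f) ≡ (p *ℤ c) *ℤ (s *ℤ f)
  regroup₁ = ℤ-Ring.solve-∀
  regroup₂ : ∀ q d s f → (q *ℤ d) *ℤ (s *ℤ f) ≡ q *ℤ ((s *ℤ d) *ℤ f)
  regroup₂ = ℤ-Ring.solve-∀

weighted-ballot-sum : ∀ n →
  IntSum.∑ n (λ k → + (k + 1) *ℤ ((+ ((2 * n ∸ k) C n) *ℤ sign n k) *ℤ + fib (k + 2)))
  ≡ + suc n
weighted-ballot-sum n = begin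
    IntSum.∑ n (λ k → + (k + 1) *ℤ ((+ ((2 * n ∸ k) C n) *ℤ sign n k) *ℤ + fib (k + 2)))
  ≡⟨ IntSum.sum-cong n (λ k k≤n → weighted-term {n} {k} k≤n) ⟩
    IntSum.∑ n (λ k → + suc n *ℤ (ballot n k *ℤ fibℤ (suc (suc k))))
  ≡⟨ sym (IntSum.sum-homo {z = 0ℤ} (_*ℤ_ (+ suc n)) (ℤ.*-distribˡ-+ (+ suc n)) n _) ⟩
    + suc n *ℤ IntSum.∑ n (λ k → ballot n k *ℤ fibℤ (suc (suc k)))
  ≡⟨ cong (_*ℤ_ (+ suc n)) (ballot-fib-sum n) ⟩
    + suc n *ℤ 1ℤ
  ≡⟨ ℤ.*-identityʳ (+ suc n) ⟩
    + suc n
  ∎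
  where open ≡-Reasoning

module RatSum = FiniteSum ℚᵘ.+-0-commutativeMonoid

mkℚᵘ-+ : ∀ d x y → mkℚᵘ (x +ℤ y) d ≃ mkℚᵘ x d +ᵘ mkℚᵘ y d
mkℚᵘ-+ d x y = *≡* (trans (cong ((x +ℤ y) *ℤ_) (ℤ.pos-* (suc d) (suc d))) (distrib x y (+ suc d)))
  where
  distrib : ∀ x y e → (x +ℤ y) *ℤ (e *ℤ e) ≡ (x *ℤ e +ℤ y *ℤ e) *ℤ e
  distrib = ℤ-Ring.solve-∀

fraction-times-integer : ∀ d p w → toℚᵘ ((p / suc d) *ℚ (w / 1)) ≃ mkℚᵘ (p *ℤ w) d
fraction-times-integer d p w = begin
    toℚᵘ ((p / suc d) *ℚ (w / 1))
  ≈⟨ ℚ.toℚᵘ-homo-* (p / suc d) (w / 1) ⟩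
    toℚᵘ (p / suc d) *ᵘ toℚᵘ (w / 1)
  ≈⟨ ℚᵘ.*-cong (ℚ.toℚᵘ-fromℚᵘ (mkℚᵘ p d)) (ℚ.toℚᵘ-fromℚᵘ (mkℚᵘ w 0)) ⟩
    mkℚᵘ p d *ᵘ mkℚᵘ w 0
  ≈⟨ *≡* (cong (λ e → (p *ℤ w) *ℤ + suc e) (sym (*-identityʳ d))) ⟩
    mkℚᵘ (p *ℤ w) d
  ∎
  where open ℚᵘ.≃-Reasoning

common-denominator : ∀ d n (p w : ℕ → ℤ) →
  sumTo 0ℚ _+ℚ_ n (λ k → (p k / suc d) *ℚ (w k / 1)) ≡ IntSum.∑ n (λ k → p k *ℤ w k) / suc d
common-denominator d n p w = ℚ.toℚᵘ-injective (begin
    toℚᵘ (sumTo 0ℚ _+ℚ_ n (λ k → (p k / suc d) *ℚ (w k / 1)))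
  ≈⟨ RatSum.sum-homo {z = 0ℚ} toℚᵘ ℚ.toℚᵘ-homo-+ n _ ⟩
    RatSum.∑ n (λ k → toℚᵘ ((p k / suc d) *ℚ (w k / 1)))
  ≈⟨ RatSum.sum-cong n (λ k _ → fraction-times-integer d (p k) (w k)) ⟩
    RatSum.∑ n (λ k → mkℚᵘ (p k *ℤ w k) d)
  ≈⟨ ℚᵘ.≃-sym (RatSum.sum-homo {z = 0ℤ} (λ x → mkℚᵘ x d) (mkℚᵘ-+ d) n _) ⟩
    mkℚᵘ (IntSum.∑ n (λ k → p k *ℤ w k)) d
  ≈⟨ ℚᵘ.≃-sym (ℚ.toℚᵘ-fromℚᵘ _) ⟩
    toℚᵘ (IntSum.∑ n (λ k → p k *ℤ w k) / suc d)
  ∎)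
  where open ℚᵘ.≃-Reasoning

self-fraction : ∀ d → + suc d / suc d ≡ 1ℚ
self-fraction d = ℚ.fromℚᵘ-cong {mkℚᵘ (+ suc d) d} {1ℚᵘ} (*≡* (ℤ.*-comm (+ suc d) 1ℤ))

mainTheorem8 : (n : ℕ) →
    (sumTo 0 _+_ n (λ k → (k + 1) C (n ∸ k)) ≡ fib (n + 2))
    × (sumTo 0ℚ _+ℚ_ n
         (λ k → ((+ (k + 1)) / suc n)
                *ℚ ((((+ ((2 * n ∸ k) C n)) *ℤ ((- (+ 1)) ^ℤ (n ∸ k))) *ℤ (+ fib (k + 2))) / 1))
       ≡ 1ℚ)
mainTheorem8 n = diagonal-identity n , (begin
    sumTo 0ℚ _+ℚ_ n (λ k → (+ (k + 1) / suc n) *ℚ (term k / 1))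
  ≡⟨ common-denominator n n (λ k → + (k + 1)) term ⟩
    IntSum.∑ n (λ k → + (k + 1) *ℤ term k) / suc n
  ≡⟨ cong (_/ suc n) (weighted-ballot-sum n) ⟩
    + suc n / suc n
  ≡⟨ self-fraction n ⟩
    1ℚ
  ∎)
  where
  open ≡-Reasoning
  term : ℕ → ℤ
  term k = (+ ((2 * n ∸ k) C n) *ℤ sign n k) *ℤ + fib (k + 2)
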